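{- Let $n>1$ be an integer every prime divisor of which is at least $7$, $A=U(n)^2$, and $\ell=3^{\Omega(n)}-1$. Let $S$ be a sequence in $\mathbb{Z}_n$ and $q$ a prime divisor of $n$. Suppose $T$ is a subsequence of consecutive terms of $S$ of length at least $(\ell+1)/3$ such that every term of $T$ is divisible by $q$. Then $S$ has an $A$-weighted zero-sum subsequence of consecutive terms.
   Context: $\mathbb{Z}_n=\mathbb{Z}/n\mathbb{Z}$, $U(n)$ its group of units, $U(n)^2=\{x^2:x\in U(n)\}$. $\Omega(n)$ is the number of prime factors of $n$ counted with multiplicity. A sequence $(x_1,\ldots,x_k)$ ($k\ge1$) in $\mathbb{Z}_n$ is an $A$-weighted zero-sum sequence if there exist $a_1,\ldots,a_k\in A$ with $a_1x_1+\cdots+a_kx_k=0$. A subsequence of consecutive terms is a nonempty block $(x_i,\ldots,x_j)$. An element of $\mathbb{Z}_n$ is divisible by a prime $q\mid n$ if its integer representatives are multiples of $q$. -}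

module Defs where

open import Data.Nat using (ℕ; zero; suc; _+_; _*_; _%_; _^_; _∸_; NonZero; _≤_; _<_)
open import Data.Nat.Primality using (Prime)
open import Data.Fin using (Fin; toℕ)
open import Data.List using (List; []; _∷_; _++_; length)
open import Data.List.Relation.Binary.Pointwise using (Pointwise)
open import Data.List.Relation.Unary.All using (All)
open import Data.Product using (Σ; ∃; _×_; _,_)
open import Relation.Binary.PropositionalEquality using (_≡_)

-- ℤ_n is represented by Fin n (canonical residues 0..n-1); congruence mod n
-- is compared via _%_ on representatives.

IsUnit : (n : ℕ) .{{_ : NonZero n}} → Fin n → Set
IsUnit n x = ∃ λ (y : Fin n) → (toℕ x * toℕ y) % n ≡ 1 % n

InA : (n : ℕ) .{{_ : NonZero n}} → Fin n → Set
InA n a = ∃ λ (u : Fin n) → IsUnit n u × toℕ a ≡ (toℕ u * toℕ u) % n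

data HasΩ : ℕ → ℕ → Set where
  Ω-one  : HasΩ 1 0
  Ω-step : ∀ {p m k} → Prime p → HasΩ m k → HasΩ (p * m) (suc k)

wsum : ∀ {n} → List (Fin n) → List (Fin n) → ℕ
wsum (a ∷ as) (x ∷ xs) = toℕ a * toℕ x + wsum as xs
wsum _ _ = 0

IsAWeightedZeroSum : (n : ℕ) .{{_ : NonZero n}} → List (Fin n) → Set
IsAWeightedZeroSum n xs =
  1 ≤ length xs ×
  (∃ λ (as : List (Fin n)) →
     Pointwise (λ a _ → InA n a) as xs × wsum as xs % n ≡ 0)

IsConsecutiveBlock : ∀ {n} → List (Fin n) → List (Fin n) → Set
IsConsecutiveBlock {n} T S =
  1 ≤ length T × ∃ λ (xs : List (Fin n)) → ∃ λ (ys : List (Fin n)) → S ≡ xs ++ T ++ ys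

module Submission where

-- Induction on the number j of prime factors of N/d: a sequence of length at
-- least 3^j all of whose terms are divisible by d has an A-weighted zero-sum
-- block (the theorem is the case d = q).  If N/d = p·m, cut the sequence into
-- consecutive segments, each a single term divisible by dp or three terms dX,
-- dY, dZ not divisible by dp together with the terms divisible by dp between
-- them; one of three greedy cuttings yields at least (length − 2)/3 segments.
-- Since p ≥ 7, the form Xα² + Yβ² + Zγ² has a zero modulo p with α, β, γ
-- units (two families of (p+1)/2 residues collide, and an explicit identity
-- handles a vanishing square), and the roots lift to units modulo N.  So each
-- segment has an A-weighted sum divisible by dp; these sums form a sequence
-- to which the induction hypothesis applies, and since A is closed under
-- multiplication a zero-sum block of sums expands to a zero-sum block of
-- the original sequence.

open import Defs
open import Data.Nat
  using (ℕ; zero; suc; _+_; _*_; _∸_; _^_; _%_; _/_; _≤_; _<_; _≤?_; _<?_; s≤s; z≤n; ∣_-_∣;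
         NonZero; >-nonZero⁻¹)
open import Data.Nat.Base using (nonTrivial⇒≢1)
open import Data.Nat.Properties
open import Data.Nat.DivMod
open import Data.Nat.Divisibility
open import Data.Nat.Coprimality as Coprime using (Coprime; coprime-divisor; coprime-Bézout; 1-coprimeTo)
open import Data.Nat.GCD using (module Bézout)
open import Data.Nat.Primality using (Prime; euclidsLemma; prime⇒nonZero; prime⇒irreducible; prime⇒nonTrivial)
open import Data.Nat.Tactic.RingSolver using (solve-∀)
open import Data.Fin using (Fin; toℕ; fromℕ<)
import Data.Fin.Properties as Fin
open import Data.List using (List; []; _∷_; _++_; [_]; length; map; concat)
open import Data.List.Properties
  using (++-assoc; ++-identityʳ; length-++; length-map; length-++-≤ˡ; map-++; concat-++; ∷-injective)
open import Data.List.Relation.Unary.All using (All; []; _∷_)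
import Data.List.Relation.Unary.All as All
open import Data.List.Relation.Unary.All.Properties using (++⁻ˡ; ++⁻ʳ; concat⁻; map⁺)
open import Data.List.Relation.Binary.Pointwise using (Pointwise; []; _∷_)
import Data.List.Relation.Binary.Pointwise as Pointwise
open import Data.Product using (Σ; ∃; ∃₂; _×_; _,_; proj₁; proj₂)
open import Data.Sum using (_⊎_; inj₁; inj₂)
open import Function using (_∘_)
open import Relation.Nullary using (¬_; yes; no; contradiction)
open import Relation.Nullary.Decidable using (from-yes)
open import Relation.Unary using (Decidable)
open import Relation.Binary.Bundles using (Setoid)
import Relation.Binary.Reasoning.Setoid as SetoidReasoning
open import Relation.Binary.PropositionalEquality
  using (_≡_; _≢_; refl; sym; trans; cong; cong₂; subst; module ≡-Reasoning)

private variable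
  A B : Set

Infix : List A → List A → Set
Infix xs ys = ∃₂ λ pre suf → ys ≡ pre ++ xs ++ suf

Infix-trans : ∀ {xs ys zs : List A} → Infix xs ys → Infix ys zs → Infix xs zs
Infix-trans {xs = xs} (pre , suf , refl) (pre′ , suf′ , refl) = pre′ ++ pre , suf ++ suf′ , (begin
  pre′ ++ (pre ++ xs ++ suf) ++ suf′     ≡⟨ cong (pre′ ++_) (++-assoc pre (xs ++ suf) suf′) ⟩
  pre′ ++ pre ++ (xs ++ suf) ++ suf′     ≡⟨ cong (λ l → pre′ ++ pre ++ l) (++-assoc xs suf suf′) ⟩
  pre′ ++ pre ++ xs ++ suf ++ suf′       ≡⟨ ++-assoc pre′ pre _ ⟨
  (pre′ ++ pre) ++ xs ++ suf ++ suf′     ∎)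
  where open ≡-Reasoning

Infix-map⁺ : ∀ (f : A → B) {xs ys} → Infix xs ys → Infix (map f xs) (map f ys)
Infix-map⁺ f {xs} (pre , suf , refl) =
  map f pre , map f suf , trans (map-++ f pre _) (cong (map f pre ++_) (map-++ f xs suf))

Infix-concat⁺ : ∀ {xss yss : List (List A)} → Infix xss yss → Infix (concat xss) (concat yss)
Infix-concat⁺ {xss = xss} (pre , suf , refl) =
  concat pre , concat suf ,
  trans (sym (concat-++ pre _)) (cong (concat pre ++_) (sym (concat-++ xss suf)))

map-≡-++⁻ : ∀ (f : A → B) xs {ys zs} → map f xs ≡ ys ++ zs →
  ∃₂ λ xs₁ xs₂ → xs ≡ xs₁ ++ xs₂ × map f xs₁ ≡ ys × map f xs₂ ≡ zs
map-≡-++⁻ f xs       {[]}     eq = [] , xs , refl , refl , eq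
map-≡-++⁻ f (x ∷ xs) {y ∷ ys} eq with ∷-injective eq
... | fx≡y , eq′ with map-≡-++⁻ f xs {ys} eq′
...   | xs₁ , xs₂ , refl , refl , refl = x ∷ xs₁ , xs₂ , refl , cong (_∷ _) fx≡y , refl

Infix-map⁻ : ∀ (f : A → B) {xs ys} → Infix ys (map f xs) → ∃ λ xs′ → Infix xs′ xs × map f xs′ ≡ ys
Infix-map⁻ f {xs} {ys} (pre , suf , eq) with map-≡-++⁻ f xs {pre} eq
... | xs₁ , xs₂ , refl , _ , eq₂ with map-≡-++⁻ f xs₂ {ys} eq₂
...   | xs′ , xs₃ , refl , fxs′≡ys , _ = xs′ , (xs₁ , xs₃ , refl) , fxs′≡ys

toList-proj₁ : ∀ {P : A → Set} {xs} (ps : All P xs) → map proj₁ (All.toList ps) ≡ xs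
toList-proj₁ []       = refl
toList-proj₁ (p ∷ ps) = cong (_ ∷_) (toList-proj₁ ps)

module Segmentation {X : Set} {Zero : X → Set} (Zero? : Decidable Zero) where

  data Segment : List X → Set where
    zero-segment   : ∀ {x} → Zero x → Segment [ x ]
    triple-segment : ∀ {x zs y zs′ z} →
      ¬ Zero x → All Zero zs → ¬ Zero y → All Zero zs′ → ¬ Zero z →
      Segment (x ∷ zs ++ y ∷ zs′ ++ [ z ])

  data Runs : List X → Set where
    last : ∀ {zs} → All Zero zs → Runs zs
    run  : ∀ {zs x xs} → All Zero zs → ¬ Zero x → Runs xs → Runs (zs ++ x ∷ xs)

  runs : ∀ xs → Runs xs
  runs [] = last []
  runs (x ∷ xs) with Zero? x | runs xs
  ... | no ¬z | r           = run [] ¬z r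
  ... | yes z | last zs     = last (z ∷ zs)
  ... | yes z | run zs ¬z r = run (z ∷ zs) ¬z r

  record PrefixParse (xs : List X) : Set where
    field
      segments : List (List X)
      valid    : All Segment segments
      rest     : List X
      split    : xs ≡ concat segments ++ rest

  record Parse (xs : List X) : Set where
    field
      segments : List (List X)
      valid    : All Segment segments
      before   : List X
      after    : List X
      split    : xs ≡ before ++ concat segments ++ after

  count : ∀ {xs} → Parse xs → ℕ
  count p = length (Parse.segments p)

  nothingParsed : ∀ xs → PrefixParse xs
  nothingParsed xs = record { segments = [] ; valid = [] ; rest = xs ; split = refl }

  castPrefixParse : ∀ {xs ys} → xs ≡ ys → PrefixParse xs → PrefixParse ys
  castPrefixParse eq p = record { PrefixParse p ; split = trans (sym eq) (PrefixParse.split p) }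

  prependSegment : ∀ {s xs} → Segment s → PrefixParse xs → PrefixParse (s ++ xs)
  prependSegment {s} seg p = record
    { segments = s ∷ segments
    ; valid    = seg ∷ valid
    ; rest     = rest
    ; split    = trans (cong (s ++_) split) (sym (++-assoc s (concat segments) rest))
    }
    where open PrefixParse p

  prependZeros : ∀ {zs xs} → All Zero zs → PrefixParse xs → PrefixParse (zs ++ xs)
  prependZeros []       p = p
  prependZeros (z ∷ az) p = prependSegment (zero-segment z) (prependZeros az p)

  length-prependZeros : ∀ {zs xs} (az : All Zero zs) (p : PrefixParse xs) →
    length (PrefixParse.segments (prependZeros az p)) ≡ length zs + length (PrefixParse.segments p)
  length-prependZeros []       p = refl
  length-prependZeros (z ∷ az) p = cong suc (length-prependZeros az p)

  zerosThen : ∀ {zs} → All Zero zs → ∀ xs → PrefixParse (zs ++ xs)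
  zerosThen az xs = prependZeros az (nothingParsed xs)

  length-zerosThen : ∀ {zs} (az : All Zero zs) xs → length (PrefixParse.segments (zerosThen az xs)) ≡ length zs
  length-zerosThen az xs = trans (length-prependZeros az (nothingParsed xs)) (+-identityʳ _)

  greedy : ∀ {xs} → Runs xs → PrefixParse xs
  greedy (last az)                     = castPrefixParse (++-identityʳ _) (zerosThen az [])
  greedy (run az _ (last _))           = zerosThen az _
  greedy (run az _ (run _ _ (last _))) = zerosThen az _
  greedy (run {x = x} az ¬x (run {zs} {y} az₁ ¬y (run {zs′} {z} {xs} az₂ ¬z r))) =
    prependZeros az (castPrefixParse reassoc (prependSegment (triple-segment ¬x az₁ ¬y az₂ ¬z) (greedy r)))
    where
    reassoc : (x ∷ zs ++ y ∷ zs′ ++ [ z ]) ++ xs ≡ x ∷ zs ++ y ∷ zs′ ++ z ∷ xs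
    reassoc = cong (x ∷_) (trans (++-assoc zs _ xs) (cong (λ l → zs ++ y ∷ l) (++-assoc zs′ [ z ] xs)))

  fromPrefixParse : ∀ {xs} → PrefixParse xs → Parse xs
  fromPrefixParse p = record { PrefixParse p ; before = [] ; after = PrefixParse.rest p }

  skip : ∀ pre {xs} → Parse xs → Parse (pre ++ xs)
  skip pre p = record
    { Parse p
    ; before = pre ++ Parse.before p
    ; split  = trans (cong (pre ++_) (Parse.split p)) (sym (++-assoc pre _ _))
    }

  shifted : ℕ → ∀ {xs} → Runs xs → Parse xs
  shifted zero                 r        = fromPrefixParse (greedy r)
  shifted (suc k) {xs}         (last _) = fromPrefixParse (nothingParsed xs)
  shifted (suc k) (run {zs} {x} _ _ r) = skip zs (skip [ x ] (shifted k r))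

  -- Each run of zeros is cut into singletons by exactly one of the three
  -- shifts, and each nonzero term but the first two completes a triple in
  -- exactly one of them.
  shifted-count : ∀ {xs} (r : Runs xs) →
    length xs ≤ count (shifted 0 r) + count (shifted 1 r) + count (shifted 2 r) + 2
  shifted-count (last {zs} az) = begin
    length zs                          ≤⟨ m≤m+n (length zs) 2 ⟩
    length zs + 2                      ≡⟨ cong (_+ 2) (length-zerosThen az []) ⟨
    count (shifted 0 (last az)) + 2    ≡⟨ arith (count (shifted 0 (last az))) ⟩
    count (shifted 0 (last az)) + 0 + 0 + 2 ∎
    where
    open ≤-Reasoning
    arith : ∀ a → a + 2 ≡ a + 0 + 0 + 2
    arith = solve-∀
  shifted-count r@(run {zs} {x} {xs} az _ (last az′)) = begin
    length (zs ++ x ∷ xs)                ≡⟨ length-++ zs ⟩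
    length zs + suc (length xs)          ≤⟨ +-monoʳ-≤ (length zs) (n≤1+n _) ⟩
    length zs + suc (suc (length xs))    ≡⟨ arith (length zs) (length xs) ⟩
    length zs + length xs + 0 + 2
      ≡⟨ cong₂ (λ a b → a + b + 0 + 2) (length-zerosThen az _) (length-zerosThen az′ []) ⟨
    count (shifted 0 r) + count (shifted 1 r) + count (shifted 2 r) + 2 ∎
    where
    open ≤-Reasoning
    arith : ∀ a b → a + suc (suc b) ≡ a + b + 0 + 2
    arith = solve-∀
  shifted-count r@(run {zs} {x} az _ (run {zs′} {y} {xs} az′ _ (last az″))) = ≤-reflexive (begin
    length (zs ++ x ∷ zs′ ++ y ∷ xs)                  ≡⟨ length-++ zs ⟩
    length zs + suc (length (zs′ ++ y ∷ xs))          ≡⟨ cong (λ n → length zs + suc n) (length-++ zs′) ⟩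
    length zs + suc (length zs′ + suc (length xs))    ≡⟨ arith (length zs) (length zs′) (length xs) ⟩
    length zs + length zs′ + length xs + 2
      ≡⟨ cong₂ (λ a b → a + b + length xs + 2) (length-zerosThen az _) (length-zerosThen az′ _) ⟨
    count (shifted 0 r) + count (shifted 1 r) + length xs + 2
      ≡⟨ cong (λ c → count (shifted 0 r) + count (shifted 1 r) + c + 2) (length-zerosThen az″ []) ⟨
    count (shifted 0 r) + count (shifted 1 r) + count (shifted 2 r) + 2 ∎)
    where
    open ≡-Reasoning
    arith : ∀ a b c → a + suc (b + suc c) ≡ a + b + c + 2
    arith = solve-∀
  shifted-count r₀@(run {zs} {x} az _ r₁@(run {zs′} {y} {xs} _ _ r₂@(run _ _ r))) = begin
    length (zs ++ x ∷ zs′ ++ y ∷ xs)           ≡⟨ length-++ zs ⟩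
    length zs + suc (length (zs′ ++ y ∷ xs))   ≤⟨ +-monoʳ-≤ (length zs) (s≤s (shifted-count r₁)) ⟩
    length zs + suc (a + b + c + 2)            ≡⟨ arith (length zs) a b c ⟩
    length zs + suc c + a + b + 2              ≡⟨ cong (λ n → n + a + b + 2) (length-prependZeros az _) ⟨
    count (shifted 0 r₀) + a + b + 2 ∎
    where
    open ≤-Reasoning
    a b c : ℕ
    a = count (shifted 0 r₁)
    b = count (shifted 0 r₂)
    c = count (shifted 0 r)
    arith : ∀ z a b c → z + suc (a + b + c + 2) ≡ z + suc c + a + b + 2
    arith = solve-∀

  larger : ∀ {xs} → Parse xs → Parse xs → Parse xs
  larger p q with count p ≤? count q
  ... | yes _ = q
  ... | no  _ = p

  count-larger : ∀ {xs} (p q : Parse xs) → count p ≤ count (larger p q) × count q ≤ count (larger p q)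
  count-larger p q with count p ≤? count q
  ... | yes p≤q = p≤q , ≤-refl
  ... | no  p≰q = ≤-refl , <⇒≤ (≰⇒> p≰q)

  segmentation : ∀ xs → Σ (Parse xs) λ p → length xs ≤ 3 * count p + 2
  segmentation xs = best , (begin
    length xs                                    ≤⟨ shifted-count r ⟩
    count p₀ + count p₁ + count p₂ + 2           ≤⟨ +-monoˡ-≤ 2 (+-mono-≤ (+-mono-≤ p₀≤ p₁≤) p₂≤) ⟩
    count best + count best + count best + 2     ≡⟨ arith (count best) ⟩
    3 * count best + 2                           ∎)
    where
    open ≤-Reasoning
    r : Runs xs
    r = runs xs
    p₀ p₁ p₂ p₀₁ best : Parse xs
    p₀ = shifted 0 r
    p₁ = shifted 1 r
    p₂ = shifted 2 r
    p₀₁ = larger p₀ p₁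
    best = larger p₀₁ p₂
    p₀≤ : count p₀ ≤ count best
    p₀≤ = ≤-trans (proj₁ (count-larger p₀ p₁)) (proj₁ (count-larger p₀₁ p₂))
    p₁≤ : count p₁ ≤ count best
    p₁≤ = ≤-trans (proj₂ (count-larger p₀ p₁)) (proj₁ (count-larger p₀₁ p₂))
    p₂≤ : count p₂ ≤ count best
    p₂≤ = proj₂ (count-larger p₀₁ p₂)
    arith : ∀ m → m + m + m + 2 ≡ 3 * m + 2
    arith = solve-∀

module Congruence (M : ℕ) .{{_ : NonZero M}} where

  infix 4 _≈_
  record _≈_ (a b : ℕ) : Set where
    constructor mod
    field %≡% : a % M ≡ b % M
  open _≈_ public

  ≈-reflexive : ∀ {a b} → a ≡ b → a ≈ b
  ≈-reflexive refl = mod refl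

  ≈-refl : ∀ {a} → a ≈ a
  ≈-refl = ≈-reflexive refl

  ≈-sym : ∀ {a b} → a ≈ b → b ≈ a
  ≈-sym (mod e) = mod (sym e)

  ≈-trans : ∀ {a b c} → a ≈ b → b ≈ c → a ≈ c
  ≈-trans (mod e) (mod f) = mod (trans e f)

  ≈-setoid : Setoid _ _
  ≈-setoid = record
    { Carrier       = ℕ
    ; _≈_           = _≈_
    ; isEquivalence = record { refl = ≈-refl ; sym = ≈-sym ; trans = ≈-trans }
    }

  module ≈-Reasoning = SetoidReasoning ≈-setoid

  +-cong : ∀ {a b c d} → a ≈ b → c ≈ d → a + c ≈ b + d
  +-cong {a} {b} {c} {d} (mod e) (mod f) = mod (begin
    (a + c) % M              ≡⟨ %-distribˡ-+ a c M ⟩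
    (a % M + c % M) % M      ≡⟨ cong₂ (λ x y → (x + y) % M) e f ⟩
    (b % M + d % M) % M      ≡⟨ %-distribˡ-+ b d M ⟨
    (b + d) % M              ∎)
    where open ≡-Reasoning

  *-cong : ∀ {a b c d} → a ≈ b → c ≈ d → a * c ≈ b * d
  *-cong {a} {b} {c} {d} (mod e) (mod f) = mod (begin
    (a * c) % M              ≡⟨ %-distribˡ-* a c M ⟩
    (a % M * (c % M)) % M    ≡⟨ cong₂ (λ x y → (x * y) % M) e f ⟩
    (b % M * (d % M)) % M    ≡⟨ %-distribˡ-* b d M ⟨
    (b * d) % M              ∎)
    where open ≡-Reasoning

  m%M≈m : ∀ a → a % M ≈ a
  m%M≈m a = mod (m%n%n≡m%n a M)

  0%M≡0 : 0 % M ≡ 0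
  0%M≡0 = n∣m⇒m%n≡0 0 M (M ∣0)

  ∣⇒≈0 : ∀ {a} → M ∣ a → a ≈ 0
  ∣⇒≈0 {a} M∣a = mod (trans (n∣m⇒m%n≡0 a M M∣a) (sym 0%M≡0))

  ≈0⇒∣ : ∀ {a} → a ≈ 0 → M ∣ a
  ≈0⇒∣ {a} (mod e) = m%n≡0⇒n∣m a M (trans e 0%M≡0)

  ∣-resp-≈ : ∀ {d a b} → d ∣ M → a ≈ b → d ∣ b → d ∣ a
  ∣-resp-≈ {d} d∣M (mod e) d∣b = ∣n∣m%n⇒∣m d∣M (subst (d ∣_) (sym e) (%-presˡ-∣ d∣b d∣M))

  ≈-negate : ∀ {a c} → a ≈ (M ∸ 1) * c → M ∣ a + c
  ≈-negate {a} {c} a≈-c =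
    ≈0⇒∣ (≈-trans (+-cong a≈-c ≈-refl) (≈-trans (≈-reflexive [M∸1]c+c≡Mc) (∣⇒≈0 (m∣m*n c))))
    where
    open ≡-Reasoning
    [M∸1]c+c≡Mc : (M ∸ 1) * c + c ≡ M * c
    [M∸1]c+c≡Mc = begin
      (M ∸ 1) * c + c       ≡⟨ cong ((M ∸ 1) * c +_) (*-identityˡ c) ⟨
      (M ∸ 1) * c + 1 * c   ≡⟨ *-distribʳ-+ c (M ∸ 1) 1 ⟨
      (M ∸ 1 + 1) * c       ≡⟨ cong (_* c) (m∸n+n≡m (>-nonZero⁻¹ M)) ⟩
      M * c                 ∎

  ≈⇒∣∣-∣ : ∀ {a b} → a ≈ b → M ∣ ∣ a - b ∣
  ≈⇒∣∣-∣ {a} {b} (mod e) = divides ∣ a / M - b / M ∣ (begin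
    ∣ a - b ∣                                    ≡⟨ cong₂ ∣_-_∣ (m≡m%n+[m/n]*n a M) (m≡m%n+[m/n]*n b M) ⟩
    ∣ a % M + a / M * M - b % M + b / M * M ∣    ≡⟨ cong (λ r → ∣ r + a / M * M - b % M + b / M * M ∣) e ⟩
    ∣ b % M + a / M * M - b % M + b / M * M ∣    ≡⟨ ∣m+n-m+o∣≡∣n-o∣ (b % M) _ _ ⟩
    ∣ a / M * M - b / M * M ∣                    ≡⟨ *-distribʳ-∣-∣ M (a / M) (b / M) ⟨
    ∣ a / M - b / M ∣ * M                        ∎)
    where open ≡-Reasoning

∣m*m-n*n∣≡[m+n]*∣m-n∣ : ∀ m n → ∣ m * m - n * n ∣ ≡ (m + n) * ∣ m - n ∣
∣m*m-n*n∣≡[m+n]*∣m-n∣ m n = begin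
  ∣ m * m - n * n ∣                    ≡⟨ ∣m+n-m+o∣≡∣n-o∣ (n * m) (m * m) (n * n) ⟨
  ∣ n * m + m * m - n * m + n * n ∣    ≡⟨ cong₂ ∣_-_∣ (expandˡ m n) (expandʳ m n) ⟩
  ∣ (m + n) * m - (m + n) * n ∣        ≡⟨ *-distribˡ-∣-∣ (m + n) m n ⟨
  (m + n) * ∣ m - n ∣                  ∎
  where
  open ≡-Reasoning
  expandˡ : ∀ m n → n * m + m * m ≡ (m + n) * m
  expandˡ = solve-∀
  expandʳ : ∀ m n → n * m + n * n ≡ (m + n) * n
  expandʳ = solve-∀

module TernaryForm {q : ℕ} (q-prime : Prime q) (7≤q : 7 ≤ q) where

  private instance
    q≢0 : NonZero q
    q≢0 = prime⇒nonZero q-prime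

  open Congruence q

  UnitZero : ℕ → ℕ → ℕ → Set
  UnitZero X Y Z = ∃₂ λ α β → ∃ λ γ →
    q ∤ α × q ∤ β × q ∤ γ × q ∣ α * α * X + β * β * Y + γ * γ * Z

  ∤-* : ∀ {a b} → q ∤ a → q ∤ b → q ∤ a * b
  ∤-* q∤a q∤b q∣ab with euclidsLemma _ _ q-prime q∣ab
  ... | inj₁ q∣a = q∤a q∣a
  ... | inj₂ q∣b = q∤b q∣b

  ∤-positive : ∀ {k} → 0 < k → k < q → q ∤ k
  ∤-positive {suc _} _ = >⇒∤

  <7⇒∤ : ∀ {k} → 0 < k → k < 7 → q ∤ k
  <7⇒∤ 0<k k<7 = ∤-positive 0<k (<-≤-trans k<7 7≤q)

  q∤1 : q ∤ 1
  q∤1 = <7⇒∤ (from-yes (0 <? 1)) (from-yes (1 <? 7))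

  q∤2 : q ∤ 2
  q∤2 = <7⇒∤ (from-yes (0 <? 2)) (from-yes (2 <? 7))

  q∤3 : q ∤ 3
  q∤3 = <7⇒∤ (from-yes (0 <? 3)) (from-yes (3 <? 7))

  q∤5 : q ∤ 5
  q∤5 = <7⇒∤ (from-yes (0 <? 5)) (from-yes (5 <? 7))

  ∣∣-∣-cancelˡ : ∀ {k a b} → q ∤ k → q ∣ ∣ k * a - k * b ∣ → q ∣ ∣ a - b ∣
  ∣∣-∣-cancelˡ {k} {a} {b} q∤k q∣
    with euclidsLemma k _ q-prime (subst (q ∣_) (sym (*-distribˡ-∣-∣ k a b)) q∣)
  ... | inj₁ q∣k     = contradiction q∣k q∤k
  ... | inj₂ q∣∣a-b∣ = q∣∣a-b∣

  ∤-offset : ∀ {c n m} → c + n ≡ m → q ∣ c → q ∤ n → q ∤ m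
  ∤-offset eq q∣c q∤n q∣m = q∤n (∣m+n∣m⇒∣n (subst (q ∣_) (sym eq) q∣m) q∣c)

  ∤-complement : ∀ {m n c} → m + n ≡ c → q ∣ c → q ∤ n → q ∤ m
  ∤-complement eq q∣c q∤n q∣m = q∤n (∣m+n∣m⇒∣n (subst (q ∣_) (sym eq) q∣c) q∣m)

  private
    4[1+w] : ∀ w → suc (4 * w + 3) ≡ suc w * 2 * 2
    4[1+w] = solve-∀

  -- t = 1 works unless w ≡ ±1 (mod q), and then t = 2 works since q ∤ 3, 5.
  goodScale : ∀ {w} → q ∤ w → ∃₂ λ t v → suc v ≡ w * t * t × q ∤ t × q ∤ v × q ∤ v + 2
  goodScale {zero} q∤w = contradiction (q ∣0) q∤w
  goodScale {suc w} q∤w with q ∣? w | q ∣? w + 2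
  ... | no q∤w′ | no q∤w+2 =
    1 , w , sym (trans (*-identityʳ (suc w * 1)) (*-identityʳ (suc w))) , q∤1 , q∤w′ , q∤w+2
  ... | yes q∣w | _ = 2 , 4 * w + 3 , 4[1+w] w , q∤2 ,
    ∤-offset refl (∣n⇒∣m*n 4 q∣w) q∤3 ,
    ∤-offset (sym (+-assoc (4 * w) 3 2)) (∣n⇒∣m*n 4 q∣w) q∤5
  ... | no _ | yes q∣w+2 = 2 , 4 * w + 3 , 4[1+w] w , q∤2 ,
    ∤-complement (plus5 w) (∣n⇒∣m*n 4 q∣w+2) q∤5 ,
    ∤-complement (plus3 w) (∣n⇒∣m*n 4 q∣w+2) q∤3
    where
    plus5 : ∀ w → 4 * w + 3 + 5 ≡ 4 * (w + 2)
    plus5 = solve-∀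
    plus3 : ∀ w → 4 * w + 3 + 2 + 3 ≡ 4 * (w + 2)
    plus3 = solve-∀

  -- If v + 1 = XYt², then (aYv)²X + (2aXYt)²Y + (Y(v+2))²Z = (Y(v+2))²(a²X + Z).
  unitZero-oneSquare : ∀ {a X Y Z} → q ∤ a → q ∤ X → q ∤ Y → q ∣ a * a * X + Z → UnitZero X Y Z
  unitZero-oneSquare {a} {X} {Y} {Z} q∤a q∤X q∤Y q∣a²X+Z with goodScale (∤-* q∤X q∤Y)
  ... | t , v , v+1≡XYt² , q∤t , q∤v , q∤v+2 =
    α , β , γ ,
    ∤-* (∤-* q∤a q∤Y) q∤v , ∤-* (∤-* (∤-* (∤-* q∤2 q∤a) q∤X) q∤Y) q∤t , ∤-* q∤Y q∤v+2 ,
    subst (q ∣_) (sym factorise) (∣n⇒∣m*n (γ * γ) q∣a²X+Z)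
    where
    open ≡-Reasoning
    α β γ : ℕ
    α = a * Y * v
    β = 2 * a * X * Y * t
    γ = Y * (v + 2)
    expand : ∀ a X Y Z v t →
      (a * Y * v) * (a * Y * v) * X + (2 * a * X * Y * t) * (2 * a * X * Y * t) * Y + (Y * (v + 2)) * (Y * (v + 2)) * Z
      ≡ (a * Y * v) * (a * Y * v) * X + 4 * a * a * X * Y * Y * (X * Y * t * t) + (Y * (v + 2)) * (Y * (v + 2)) * Z
    expand = solve-∀
    collect : ∀ a X Y Z v →
      (a * Y * v) * (a * Y * v) * X + 4 * a * a * X * Y * Y * suc v + (Y * (v + 2)) * (Y * (v + 2)) * Z
      ≡ (Y * (v + 2)) * (Y * (v + 2)) * (a * a * X + Z)
    collect = solve-∀
    factorise : α * α * X + β * β * Y + γ * γ * Z ≡ γ * γ * (a * a * X + Z)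
    factorise = begin
      α * α * X + β * β * Y + γ * γ * Z                                 ≡⟨ expand a X Y Z v t ⟩
      α * α * X + 4 * a * a * X * Y * Y * (X * Y * t * t) + γ * γ * Z
        ≡⟨ cong (λ w → α * α * X + 4 * a * a * X * Y * Y * w + γ * γ * Z) v+1≡XYt² ⟨
      α * α * X + 4 * a * a * X * Y * Y * suc v + γ * γ * Z             ≡⟨ collect a X Y Z v ⟩
      γ * γ * (a * a * X + Z)                                           ∎

  half : ∃ λ h → h + h ≡ suc q
  half with q % 2 | m≡m%n+[m/n]*n q 2 | m%n<n q 2
  ... | 0 | q≡[q/2]*2 | _ = contradiction (prime⇒irreducible q-prime (divides (q / 2) q≡[q/2]*2)) 2∤q
    where
    2∤q : ¬ (2 ≡ 1 ⊎ 2 ≡ q)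
    2∤q (inj₁ ())
    2∤q (inj₂ 2≡q) = <⇒≢ (<-≤-trans (from-yes (2 <? 7)) 7≤q) 2≡q
  ... | 1 | q≡1+[q/2]*2 | _ = suc (q / 2) , trans (double (q / 2)) (cong suc (sym q≡1+[q/2]*2))
    where
    double : ∀ k → suc k + suc k ≡ suc (1 + k * 2)
    double = solve-∀
  ... | suc (suc _) | _ | s≤s (s≤s ())

  half≤ : ∀ {h} → h + h ≡ suc q → h ≤ q
  half≤ {suc h} h+h≡1+q = subst (suc h ≤_) (suc-injective h+h≡1+q) (m≤n+m (suc h) h)

  module _ {h : ℕ} (h+h≡1+q : h + h ≡ suc q) where

    squares-incongruent : ∀ {i j} → i < h → j < h → i ≢ j → q ∤ ∣ i * i - j * j ∣
    squares-incongruent {i} {j} i<h j<h i≢j q∣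
      with euclidsLemma (i + j) ∣ i - j ∣ q-prime (subst (q ∣_) (∣m*m-n*n∣≡[m+n]*∣m-n∣ i j) q∣)
    ... | inj₁ q∣i+j = ∤-positive 0<i+j i+j<q q∣i+j
      where
      0<i+j : 0 < i + j
      0<i+j = n≢0⇒n>0 (λ i+j≡0 → i≢j (trans (m+n≡0⇒m≡0 i i+j≡0) (sym (m+n≡0⇒n≡0 i i+j≡0))))
      i+j<q : i + j < q
      i+j<q = subst (_≤ q) (+-suc i j) (≤-pred (subst (suc i + suc j ≤_) h+h≡1+q (+-mono-≤ i<h j<h)))
    ... | inj₂ q∣∣i-j∣ = ∤-positive 0<∣i-j∣ ∣i-j∣<q q∣∣i-j∣
      where
      0<∣i-j∣ : 0 < ∣ i - j ∣
      0<∣i-j∣ = n≢0⇒n>0 (i≢j ∘ ∣m-n∣≡0⇒m≡n)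
      ∣i-j∣<q : ∣ i - j ∣ < q
      ∣i-j∣<q = ≤-<-trans (∣m-n∣≤m⊔n i j) (<-≤-trans (⊔-lub i<h j<h) (half≤ h+h≡1+q))

    module _ {X Y : ℕ} (q∤X : q ∤ X) (q∤Y : q ∤ Y) (Z : ℕ) where

      -- The values X a² and −(Z + Y b²) for a, b < h: 2h > q of them, so two
      -- are congruent, and two of the same family cannot be.
      candidate : ℕ → ℕ
      candidate k with k <? h
      ... | yes _ = X * (k * k)
      ... | no  _ = (q ∸ 1) * (Z + Y * ((k ∸ h) * (k ∸ h)))

      q∤q∸1 : q ∤ q ∸ 1
      q∤q∸1 = ∤-positive (m<n⇒0<n∸m 1<q) (∸-monoʳ-< (s≤s z≤n) (<⇒≤ 1<q))
        where
        1<q : 1 < q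
        1<q = <-≤-trans (from-yes (1 <? 7)) 7≤q

      ∸h<h : ∀ {k} → h ≤ k → k < h + h → k ∸ h < h
      ∸h<h {k} h≤k k<2h = +-cancelˡ-< h (k ∸ h) h (subst (_< h + h) (sym (m+[n∸m]≡n h≤k)) k<2h)

      collision : ∀ {i j} → i < j → j < h + h → candidate i ≈ candidate j →
        ∃₂ λ a b → a < h × b < h × q ∣ a * a * X + b * b * Y + Z
      collision {i} {j} i<j j<2h cᵢ≈cⱼ with i <? h | j <? h
      ... | yes i<h | yes j<h =
        contradiction (∣∣-∣-cancelˡ q∤X (≈⇒∣∣-∣ cᵢ≈cⱼ)) (squares-incongruent i<h j<h (<⇒≢ i<j))
      ... | no i≮h | yes j<h = contradiction (<-trans i<j j<h) i≮h
      ... | yes i<h | no j≮h =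
        i , j ∸ h , i<h , ∸h<h (≮⇒≥ j≮h) j<2h , subst (q ∣_) (rearrange X i Z Y (j ∸ h)) (≈-negate cᵢ≈cⱼ)
        where
        rearrange : ∀ X a Z Y b → X * (a * a) + (Z + Y * (b * b)) ≡ a * a * X + b * b * Y + Z
        rearrange = solve-∀
      ... | no i≮h | no j≮h = contradiction q∣∣a²-b²∣ (squares-incongruent a<h b<h a≢b)
        where
        a b : ℕ
        a = i ∸ h
        b = j ∸ h
        a<h : a < h
        a<h = ∸h<h (≮⇒≥ i≮h) (<-trans i<j j<2h)
        b<h : b < h
        b<h = ∸h<h (≮⇒≥ j≮h) j<2h
        a≢b : a ≢ b
        a≢b = <⇒≢ i<j ∘ ∸-cancelʳ-≡ (≮⇒≥ i≮h) (≮⇒≥ j≮h)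
        q∣∣a²-b²∣ : q ∣ ∣ a * a - b * b ∣
        q∣∣a²-b²∣ = ∣∣-∣-cancelˡ q∤Y (subst (q ∣_) (∣m+n-m+o∣≡∣n-o∣ Z _ _)
          (∣∣-∣-cancelˡ q∤q∸1 (≈⇒∣∣-∣ cᵢ≈cⱼ)))

      residue : Fin (h + h) → Fin q
      residue k = fromℕ< (m%n<n (candidate (toℕ k)) q)

      twoSquares : ∃₂ λ a b → a < h × b < h × q ∣ a * a * X + b * b * Y + Z
      twoSquares with Fin.pigeonhole (subst (q <_) (sym h+h≡1+q) (n<1+n q)) residue
      ... | i , j , i<j , residueᵢ≡residueⱼ = collision i<j (Fin.toℕ<n j) (mod (begin
        candidate (toℕ i) % q   ≡⟨ Fin.toℕ-fromℕ< _ ⟨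
        toℕ (residue i)         ≡⟨ cong toℕ residueᵢ≡residueⱼ ⟩
        toℕ (residue j)         ≡⟨ Fin.toℕ-fromℕ< _ ⟩
        candidate (toℕ j) % q   ∎))
        where open ≡-Reasoning

  unitZero-swap : ∀ {X Y Z} → UnitZero Y X Z → UnitZero X Y Z
  unitZero-swap {X} {Y} {Z} (β , α , γ , q∤β , q∤α , q∤γ , q∣) =
    α , β , γ , q∤α , q∤β , q∤γ , subst (q ∣_) (cong (_+ γ * γ * Z) (+-comm (β * β * Y) (α * α * X))) q∣

  unitZero-twoSquares : ∀ {X Y Z} → q ∤ X → q ∤ Y → q ∤ Z →
    ∀ a b → a < q → b < q → q ∣ a * a * X + b * b * Y + Z → UnitZero X Y Z
  unitZero-twoSquares q∤X q∤Y q∤Z zero zero _ _ q∣Z = contradiction q∣Z q∤Z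
  unitZero-twoSquares {X} {Y} {Z} q∤X q∤Y q∤Z (suc a) zero a<q _ q∣ =
    unitZero-oneSquare (∤-positive (s≤s z≤n) a<q) q∤X q∤Y
      (subst (q ∣_) (cong (_+ Z) (+-identityʳ (suc a * suc a * X))) q∣)
  unitZero-twoSquares q∤X q∤Y q∤Z zero (suc b) _ b<q q∣ =
    unitZero-swap (unitZero-oneSquare (∤-positive (s≤s z≤n) b<q) q∤Y q∤X q∣)
  unitZero-twoSquares {X} {Y} {Z} q∤X q∤Y q∤Z (suc a) (suc b) a<q b<q q∣ =
    suc a , suc b , 1 , ∤-positive (s≤s z≤n) a<q , ∤-positive (s≤s z≤n) b<q , q∤1 ,
    subst (λ c → q ∣ suc a * suc a * X + suc b * suc b * Y + c) (sym (+-identityʳ Z)) q∣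

  unitZero : ∀ {X Y Z} → q ∤ X → q ∤ Y → q ∤ Z → UnitZero X Y Z
  unitZero {X} {Y} {Z} q∤X q∤Y q∤Z =
    let h , h+h≡1+q = half
        a , b , a<h , b<h , q∣ = twoSquares {h} h+h≡1+q q∤X q∤Y Z
        h≤q = half≤ {h} h+h≡1+q
    in unitZero-twoSquares q∤X q∤Y q∤Z a b (<-≤-trans a<h h≤q) (<-≤-trans b<h h≤q) q∣

prime≢1 : ∀ {p} → Prime p → p ≢ 1
prime≢1 p-prime = nonTrivial⇒≢1 {{prime⇒nonTrivial p-prime}}

coprime-* : ∀ {u a b} → Coprime u a → Coprime u b → Coprime u (a * b)
coprime-* {u} {a} u⊥a u⊥b {d} (d∣u , d∣ab) = u⊥b (d∣u , coprime-divisor d⊥a d∣ab)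
  where
  d⊥a : Coprime d a
  d⊥a (e∣d , e∣a) = u⊥a (∣-trans e∣d d∣u , e∣a)

∤⇒coprime : ∀ {p u} → Prime p → p ∤ u → Coprime u p
∤⇒coprime p-prime p∤u (d∣u , d∣p) with prime⇒irreducible p-prime d∣p
... | inj₁ d≡1 = d≡1
... | inj₂ refl = contradiction d∣u p∤u

module _ {p : ℕ} (p-prime : Prime p) where

  private instance
    p≢0 : NonZero p
    p≢0 = prime⇒nonZero p-prime

  open Congruence p

  -- When the new prime factor r ≠ p of r·m divides the lift u for m, the lift
  -- u + m·p is still coprime to m and now prime to r.
  coprimeLift : ∀ {m j α} → HasΩ m j → p ∤ α → ∃ λ u → u ≈ α × Coprime u m
  coprimeLift {α = α} Ω-one p∤α = α , ≈-refl , Coprime.sym (1-coprimeTo α)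
  coprimeLift (Ω-step {r} {m} r-prime Ωm) p∤α with coprimeLift Ωm p∤α
  ... | u , u≈α , u⊥m with r ∣? u
  ...   | no r∤u = u , u≈α , coprime-* (∤⇒coprime r-prime r∤u) u⊥m
  ...   | yes r∣u with r ≟ p
  ...     | yes refl = contradiction (≈0⇒∣ (≈-trans (≈-sym u≈α) (∣⇒≈0 r∣u))) p∤α
  ...     | no r≢p = u + m * p , ≈-trans (mod ([m+kn]%n≡m%n u m p)) u≈α , coprime-* r⊥u′ u′⊥m
    where
    u′⊥m : Coprime (u + m * p) m
    u′⊥m {d} (d∣u′ , d∣m) =
      u⊥m (∣m+n∣m⇒∣n (subst (d ∣_) (+-comm u (m * p)) d∣u′) (∣m⇒∣m*n p d∣m) , d∣m)
    r∤u′ : r ∤ u + m * p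
    r∤u′ r∣u′ with euclidsLemma m p r-prime (∣m+n∣m⇒∣n r∣u′ r∣u)
    ... | inj₁ r∣m = prime≢1 r-prime (u⊥m (r∣u , r∣m))
    ... | inj₂ r∣p with prime⇒irreducible p-prime r∣p
    ...   | inj₁ r≡1 = prime≢1 r-prime r≡1
    ...   | inj₂ r≡p = r≢p r≡p
    r⊥u′ : Coprime (u + m * p) r
    r⊥u′ = ∤⇒coprime r-prime r∤u′

sqWeightedSum : ∀ {n} → List ℕ → List (Fin n) → ℕ
sqWeightedSum (u ∷ us) (x ∷ xs) = u * u * toℕ x + sqWeightedSum us xs
sqWeightedSum _        _        = 0

sqWeightedSum-++ : ∀ {n} {R : ℕ → Fin n → Set} {us xs} → Pointwise R us xs →
  ∀ vs ys → sqWeightedSum (us ++ vs) (xs ++ ys) ≡ sqWeightedSum us xs + sqWeightedSum vs ys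
sqWeightedSum-++ []                    vs ys = refl
sqWeightedSum-++ (_∷_ {u} {x} _ us∼xs) vs ys =
  trans (cong (u * u * toℕ x +_) (sqWeightedSum-++ us∼xs vs ys)) (sym (+-assoc (u * u * toℕ x) _ _))

sqWeightedSum-scale : ∀ {n} w us (xs : List (Fin n)) →
  sqWeightedSum (map (w *_) us) xs ≡ w * w * sqWeightedSum us xs
sqWeightedSum-scale w []       xs       = sym (*-zeroʳ (w * w))
sqWeightedSum-scale w (u ∷ us) []       = sym (*-zeroʳ (w * w))
sqWeightedSum-scale w (u ∷ us) (x ∷ xs) =
  trans (cong (w * u * (w * u) * toℕ x +_) (sqWeightedSum-scale w us xs)) (distribute w u (toℕ x) _)
  where
  distribute : ∀ w u x s → w * u * (w * u) * x + w * w * s ≡ w * w * (u * u * x + s)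
  distribute = solve-∀

∣-sqWeightedSum : ∀ {n d} us {xs : List (Fin n)} → All (λ x → d ∣ toℕ x) xs → d ∣ sqWeightedSum us xs
∣-sqWeightedSum []       _             = _ ∣0
∣-sqWeightedSum (u ∷ us) []            = _ ∣0
∣-sqWeightedSum (u ∷ us) (d∣x ∷ d∣xs) = ∣m∣n⇒∣m+n (∣n⇒∣m*n (u * u) d∣x) (∣-sqWeightedSum us d∣xs)

module Weights (N : ℕ) .{{_ : NonZero N}} where

  open Congruence N

  coprime⇒invertible : ∀ {u} → Coprime u N → ∃ λ v → u * v ≈ 1
  coprime⇒invertible {u} u⊥N with coprime-Bézout u⊥N
  ... | Bézout.+- x y 1+yN≡xu = x , mod (begin
    (u * x) % N        ≡⟨ cong (_% N) (trans (*-comm u x) (sym 1+yN≡xu)) ⟩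
    (1 + y * N) % N    ≡⟨ [m+kn]%n≡m%n 1 y N ⟩
    1 % N              ∎)
    where open ≡-Reasoning
  ... | Bézout.-+ x y 1+xu≡yN = (N ∸ 1) * x , mod (begin
    (u * ((N ∸ 1) * x)) % N                ≡⟨ [m+kn]%n≡m%n _ y N ⟨
    (u * ((N ∸ 1) * x) + y * N) % N        ≡⟨ cong (λ n → (u * ((N ∸ 1) * x) + n) % N) 1+xu≡yN ⟨
    (u * ((N ∸ 1) * x) + (1 + x * u)) % N  ≡⟨ cong (_% N) (collect u (N ∸ 1) x) ⟩
    (1 + x * u * (N ∸ 1 + 1)) % N          ≡⟨ cong (λ n → (1 + x * u * n) % N) (m∸n+n≡m (>-nonZero⁻¹ N)) ⟩
    (1 + x * u * N) % N                    ≡⟨ [m+kn]%n≡m%n 1 (x * u) N ⟩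
    1 % N                                  ∎)
    where
    open ≡-Reasoning
    collect : ∀ u m x → u * (m * x) + (1 + x * u) ≡ 1 + x * u * (m + 1)
    collect = solve-∀

  fin : ℕ → Fin N
  fin a = fromℕ< (m%n<n a N)

  toℕ-fin : ∀ a → toℕ (fin a) ≈ a
  toℕ-fin a = ≈-trans (≈-reflexive (Fin.toℕ-fromℕ< _)) (m%M≈m a)

  square : ℕ → Fin N
  square u = fin (u * u)

  square∈A : ∀ {u} → Coprime u N → InA N (square u)
  square∈A {u} u⊥N =
    let v , uv≈1 = coprime⇒invertible u⊥N
    in fin u , (fin v , %≡% (≈-trans (*-cong (toℕ-fin u) (toℕ-fin v)) uv≈1)) ,
       trans (Fin.toℕ-fromℕ< _) (%≡% (≈-sym (*-cong (toℕ-fin u) (toℕ-fin u))))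

  CoprimeRoot : ℕ → Fin N → Set
  CoprimeRoot u _ = Coprime u N

  wsum-square : ∀ us (xs : List (Fin N)) → wsum (map square us) xs ≈ sqWeightedSum us xs
  wsum-square []       xs       = ≈-refl
  wsum-square (u ∷ us) []       = ≈-refl
  wsum-square (u ∷ us) (x ∷ xs) = +-cong (*-cong (toℕ-fin (u * u)) ≈-refl) (wsum-square us xs)

  -- The weights are kept as square roots coprime to N, and the weighted sum
  -- is not reduced modulo N.
  record IsAWeightedZeroSumMod (Q : ℕ) (xs : List (Fin N)) : Set where
    field
      nonempty  : 1 ≤ length xs
      roots     : List ℕ
      coprime   : Pointwise CoprimeRoot roots xs
      divisible : Q ∣ sqWeightedSum roots xs

  toIsAWeightedZeroSum : ∀ {xs} → IsAWeightedZeroSumMod N xs → IsAWeightedZeroSum N xs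
  toIsAWeightedZeroSum {xs} w =
    nonempty , map square roots , squares∈A coprime ,
    trans (%≡% (≈-trans (wsum-square roots xs) (∣⇒≈0 divisible))) 0%M≡0
    where
    open IsAWeightedZeroSumMod w
    squares∈A : ∀ {us ys} → Pointwise CoprimeRoot us ys → Pointwise (λ a _ → InA N a) (map square us) ys
    squares∈A []           = []
    squares∈A (u⊥N ∷ us⊥N) = square∈A u⊥N ∷ squares∈A us⊥N

  WeightedSegment : ℕ → Set
  WeightedSegment Q = Σ (List (Fin N)) (IsAWeightedZeroSumMod Q)

  value : ∀ {Q} → WeightedSegment Q → Fin N
  value (xs , w) = fin (sqWeightedSum (IsAWeightedZeroSumMod.roots w) xs)

  elements : ∀ {Q} → List (WeightedSegment Q) → List (Fin N)
  elements ss = concat (map proj₁ ss)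

  coprime-scale : ∀ {u rs xs} → Coprime u N → Pointwise CoprimeRoot rs xs →
    Pointwise CoprimeRoot (map (u *_) rs) xs
  coprime-scale u⊥N []           = []
  coprime-scale u⊥N (r⊥N ∷ rs⊥N) =
    Coprime.sym (coprime-* (Coprime.sym u⊥N) (Coprime.sym r⊥N)) ∷ coprime-scale u⊥N rs⊥N

  concatWeighting : ∀ {Q} (ss : List (WeightedSegment Q)) {us} → Pointwise CoprimeRoot us (map value ss) →
    ∃ λ rs → Pointwise CoprimeRoot rs (elements ss) ×
             sqWeightedSum rs (elements ss) ≈ sqWeightedSum us (map value ss)
  concatWeighting []              []             = [] , [] , ≈-refl
  concatWeighting ((xs , w) ∷ ss) {u ∷ us} (u⊥N ∷ us⊥N) =
    let rs , rs⊥N , sum≈ = concatWeighting ss us⊥N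
    in map (u *_) roots ++ rs , Pointwise.++⁺ scaled rs⊥N , (begin
      sqWeightedSum (map (u *_) roots ++ rs) (xs ++ elements ss)
        ≡⟨ sqWeightedSum-++ scaled rs (elements ss) ⟩
      sqWeightedSum (map (u *_) roots) xs + sqWeightedSum rs (elements ss)
        ≡⟨ cong (_+ sqWeightedSum rs (elements ss)) (sqWeightedSum-scale u roots xs) ⟩
      u * u * sqWeightedSum roots xs + sqWeightedSum rs (elements ss)
        ≈⟨ +-cong (*-cong (≈-refl {u * u}) (≈-sym (toℕ-fin (sqWeightedSum roots xs)))) sum≈ ⟩
      u * u * toℕ (value (xs , w)) + sqWeightedSum us (map value ss) ∎)
    where
    open IsAWeightedZeroSumMod w
    open ≈-Reasoning
    scaled : Pointwise CoprimeRoot (map (u *_) roots) xs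
    scaled = coprime-scale u⊥N coprime

  zeroSum-elements : ∀ {Q} (ss : List (WeightedSegment Q)) →
    IsAWeightedZeroSumMod N (map value ss) → IsAWeightedZeroSumMod N (elements ss)
  zeroSum-elements ss w =
    let rs , rs⊥N , sum≈ = concatWeighting ss (IsAWeightedZeroSumMod.coprime w)
    in record
      { nonempty  = nonempty-elements ss (IsAWeightedZeroSumMod.nonempty w)
      ; roots     = rs
      ; coprime   = rs⊥N
      ; divisible = ∣-resp-≈ ∣-refl sum≈ (IsAWeightedZeroSumMod.divisible w)
      }
    where
    nonempty-elements : ∀ {Q} (ss : List (WeightedSegment Q)) →
      1 ≤ length (map value ss) → 1 ≤ length (elements ss)
    nonempty-elements ((xs , w) ∷ _) _ = ≤-trans (IsAWeightedZeroSumMod.nonempty w) (length-++-≤ˡ xs)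

HasΩ-cofactor : ∀ {n k q} → HasΩ n k → Prime q → q ∣ n →
  ∃ λ k′ → k ≡ suc k′ × ∃ λ m → q * m ≡ n × HasΩ m k′
HasΩ-cofactor Ω-one q-prime q∣1 = contradiction (∣1⇒≡1 q∣1) (prime≢1 q-prime)
HasΩ-cofactor {q = q} (Ω-step {p} {m} {k} p-prime Ωm) q-prime q∣pm with q ≟ p
... | yes refl = k , refl , m , refl , Ωm
... | no q≢p with euclidsLemma p m q-prime q∣pm
...   | inj₁ q∣p with prime⇒irreducible p-prime q∣p
...     | inj₁ q≡1 = contradiction q≡1 (prime≢1 q-prime)
...     | inj₂ q≡p = contradiction q≡p q≢p
HasΩ-cofactor {q = q} (Ω-step {p} {m} {k} p-prime Ωm) q-prime q∣pm | no q≢p | inj₂ q∣m =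
  let k′ , k≡1+k′ , m′ , qm′≡m , Ωm′ = HasΩ-cofactor Ωm q-prime q∣m
  in k , refl , p * m′ , trans (x*[y*z]≡y*[x*z] q p m′) (cong (p *_) qm′≡m) ,
     subst (HasΩ (p * m′)) (sym k≡1+k′) (Ω-step p-prime Ωm′)
  where
  x*[y*z]≡y*[x*z] : ∀ x y z → x * (y * z) ≡ y * (x * z)
  x*[y*z]≡y*[x*z] = solve-∀

3^[1+j]≤3s+2⇒3^j≤s : ∀ j s → 3 ^ suc j ≤ 3 * s + 2 → 3 ^ j ≤ s
3^[1+j]≤3s+2⇒3^j≤s j s 3^[1+j]≤3s+2 =
  ≮⇒≥ λ s<3^j → <⇒≱ (≤-trans (≤-reflexive (3s+3≡3[1+s] s)) (*-monoʳ-≤ 3 s<3^j)) 3^[1+j]≤3s+2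
  where
  3s+3≡3[1+s] : ∀ s → suc (3 * s + 2) ≡ 3 * suc s
  3s+3≡3[1+s] = solve-∀

module ZeroSumBlocks (N : ℕ) .{{_ : NonZero N}} (N-factors≥7 : ∀ p → Prime p → p ∣ N → 7 ≤ p)
                     {k : ℕ} (ΩN : HasΩ N k) where

  open Weights N

  HasZeroSumBlock : List (Fin N) → Set
  HasZeroSumBlock xs = ∃ λ B → Infix B xs × IsAWeightedZeroSumMod N B

  singletonBlock : ∀ {xs} → All (λ x → N ∣ toℕ x) xs → 1 ≤ length xs → HasZeroSumBlock xs
  singletonBlock {x ∷ xs} (N∣x ∷ _) _ = [ x ] , ([] , xs , refl) , record
    { nonempty  = s≤s z≤n
    ; roots     = [ 1 ]
    ; coprime   = 1-coprimeTo N ∷ []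
    ; divisible = ∣-sqWeightedSum [ 1 ] (N∣x ∷ [])
    }

  module Step {d p m : ℕ} (p-prime : Prime p) (d*pm≡N : d * (p * m) ≡ N) where

    private instance
      p≢0 : NonZero p
      p≢0 = prime⇒nonZero p-prime

    Q : ℕ
    Q = d * p

    Q∣N : Q ∣ N
    Q∣N = divides m (trans (sym d*pm≡N) (trans (sym (*-assoc d p m)) (*-comm Q m)))

    p∣N : p ∣ N
    p∣N = ∣-trans (n∣m*n d) Q∣N

    open Segmentation (λ (x : Fin N) → Q ∣? toℕ x)
    open TernaryForm p-prime (N-factors≥7 p p-prime p∣N) using (unitZero)
    open Congruence p using ()
      renaming (_≈_ to _≈ₚ_; ≈-refl to ≈ₚ-refl; ≈-trans to ≈ₚ-trans; +-cong to +-congₚ; *-cong to *-congₚ;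
                ∣⇒≈0 to ∣⇒≈ₚ0; ≈0⇒∣ to ≈ₚ0⇒∣)

    p∤cofactor : ∀ {x : Fin N} {X} → toℕ x ≡ X * d → ¬ Q ∣ toℕ x → p ∤ X
    p∤cofactor {x} {X} x≡Xd Q∤x p∣X = Q∤x (subst (Q ∣_) (trans (*-comm d X) (sym x≡Xd)) (*-monoʳ-∣ d p∣X))

    ones : List (Fin N) → List ℕ
    ones = map (λ _ → 1)

    ones-coprime : ∀ xs → Pointwise CoprimeRoot (ones xs) xs
    ones-coprime []       = []
    ones-coprime (_ ∷ xs) = 1-coprimeTo N ∷ ones-coprime xs

    ∣-resp-roots : ∀ {X Y Z α β γ u v w} → u ≈ₚ α → v ≈ₚ β → w ≈ₚ γ →
      p ∣ α * α * X + β * β * Y + γ * γ * Z → p ∣ u * u * X + v * v * Y + w * w * Z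
    ∣-resp-roots u≈α v≈β w≈γ p∣form = ≈ₚ0⇒∣ (≈ₚ-trans
      (+-congₚ (+-congₚ (*-congₚ (*-congₚ u≈α u≈α) ≈ₚ-refl) (*-congₚ (*-congₚ v≈β v≈β) ≈ₚ-refl))
               (*-congₚ (*-congₚ w≈γ w≈γ) ≈ₚ-refl))
      (∣⇒≈ₚ0 p∣form))

    tripleWeighting : ∀ {x zs y zs′ z X Y Z u v w} → toℕ x ≡ X * d → toℕ y ≡ Y * d → toℕ z ≡ Z * d →
      All (λ t → Q ∣ toℕ t) zs → All (λ t → Q ∣ toℕ t) zs′ →
      Coprime u N → Coprime v N → Coprime w N → p ∣ u * u * X + v * v * Y + w * w * Z →
      IsAWeightedZeroSumMod Q (x ∷ zs ++ y ∷ zs′ ++ [ z ])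
    tripleWeighting {x} {zs} {y} {zs′} {z} {X} {Y} {Z} {u} {v} {w}
                    x≡Xd y≡Yd z≡Zd Q∣zs Q∣zs′ u⊥N v⊥N w⊥N p∣cofactors = record
      { nonempty  = s≤s z≤n
      ; roots     = u ∷ ones zs ++ v ∷ ones zs′ ++ [ w ]
      ; coprime   = u⊥N ∷ Pointwise.++⁺ (ones-coprime zs) (v⊥N ∷ Pointwise.++⁺ (ones-coprime zs′) (w⊥N ∷ []))
      ; divisible = subst (Q ∣_) (sym split)
          (∣m∣n⇒∣m+n Q∣triple
            (∣m∣n⇒∣m+n (∣-sqWeightedSum (ones zs) Q∣zs) (∣-sqWeightedSum (ones zs′) Q∣zs′)))
      }
      where
      open ≡-Reasoning
      S S′ : ℕ
      S  = sqWeightedSum (ones zs) zs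
      S′ = sqWeightedSum (ones zs′) zs′
      split : sqWeightedSum (u ∷ ones zs ++ v ∷ ones zs′ ++ [ w ]) (x ∷ zs ++ y ∷ zs′ ++ [ z ])
            ≡ u * u * toℕ x + v * v * toℕ y + w * w * toℕ z + (S + S′)
      split = begin
        u * u * toℕ x + sqWeightedSum (ones zs ++ v ∷ ones zs′ ++ [ w ]) (zs ++ y ∷ zs′ ++ [ z ])
          ≡⟨ cong (u * u * toℕ x +_) (sqWeightedSum-++ (ones-coprime zs) _ _) ⟩
        u * u * toℕ x + (S + (v * v * toℕ y + sqWeightedSum (ones zs′ ++ [ w ]) (zs′ ++ [ z ])))
          ≡⟨ cong (λ s → u * u * toℕ x + (S + (v * v * toℕ y + s))) (sqWeightedSum-++ (ones-coprime zs′) _ _) ⟩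
        u * u * toℕ x + (S + (v * v * toℕ y + (S′ + (w * w * toℕ z + 0))))
          ≡⟨ regroup (u * u * toℕ x) (v * v * toℕ y) (w * w * toℕ z) S S′ ⟩
        u * u * toℕ x + v * v * toℕ y + w * w * toℕ z + (S + S′) ∎
        where
        regroup : ∀ a b c s t → a + (s + (b + (t + (c + 0)))) ≡ a + b + c + (s + t)
        regroup = solve-∀
      Q∣triple : Q ∣ u * u * toℕ x + v * v * toℕ y + w * w * toℕ z
      Q∣triple = subst (Q ∣_) (trans (distribute d u v w X Y Z) (sym (cong₃ x≡Xd y≡Yd z≡Zd)))
                       (*-monoʳ-∣ d p∣cofactors)
        where
        distribute : ∀ d u v w X Y Z →
          d * (u * u * X + v * v * Y + w * w * Z) ≡ u * u * (X * d) + v * v * (Y * d) + w * w * (Z * d)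
        distribute = solve-∀
        cong₃ : ∀ {a a′ b b′ c c′} → a ≡ a′ → b ≡ b′ → c ≡ c′ →
          u * u * a + v * v * b + w * w * c ≡ u * u * a′ + v * v * b′ + w * w * c′
        cong₃ refl refl refl = refl

    segmentWeighting : ∀ {s} → Segment s → All (λ x → d ∣ toℕ x) s → IsAWeightedZeroSumMod Q s
    segmentWeighting (zero-segment Q∣x) _ = record
      { nonempty  = s≤s z≤n
      ; roots     = [ 1 ]
      ; coprime   = 1-coprimeTo N ∷ []
      ; divisible = ∣-sqWeightedSum [ 1 ] (Q∣x ∷ [])
      }
    segmentWeighting (triple-segment {zs = zs} {zs′ = zs′} Q∤x Q∣zs Q∤y Q∣zs′ Q∤z) (d∣x ∷ d∣rest) =
      let divides X x≡Xd = d∣x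
          divides Y y≡Yd = All.head (++⁻ʳ zs d∣rest)
          divides Z z≡Zd = All.head (++⁻ʳ zs′ (All.tail (++⁻ʳ zs d∣rest)))
          α , β , γ , p∤α , p∤β , p∤γ , p∣form =
            unitZero {X} {Y} {Z} (p∤cofactor x≡Xd Q∤x) (p∤cofactor y≡Yd Q∤y) (p∤cofactor z≡Zd Q∤z)
          u , u≈α , u⊥N = coprimeLift p-prime ΩN p∤α
          v , v≈β , v⊥N = coprimeLift p-prime ΩN p∤β
          w , w≈γ , w⊥N = coprimeLift p-prime ΩN p∤γ
      in tripleWeighting {X = X} {Y = Y} {Z = Z} x≡Xd y≡Yd z≡Zd Q∣zs Q∣zs′ u⊥N v⊥N w⊥N
           (∣-resp-roots u≈α v≈β w≈γ p∣form)

    Q∣value : ∀ (s : WeightedSegment Q) → Q ∣ toℕ (value s)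
    Q∣value (xs , w) =
      subst (Q ∣_) (sym (Fin.toℕ-fromℕ< _)) (%-presˡ-∣ (IsAWeightedZeroSumMod.divisible w) Q∣N)

    HasZeroSumBlocksFrom : ℕ → Set
    HasZeroSumBlocksFrom ℓ = ∀ {xs} → All (λ x → Q ∣ toℕ x) xs → ℓ ≤ length xs → HasZeroSumBlock xs

    expandBlock : ∀ {ℓ xs} → HasZeroSumBlocksFrom ℓ → All (λ x → d ∣ toℕ x) xs →
      (parse : Parse xs) → ℓ ≤ count parse → HasZeroSumBlock xs
    expandBlock {ℓ} {xs} blocksQ d∣xs parse ℓ≤count =
      let B , B⊆values , B-zeroSum = blocksQ (map⁺ (All.universal Q∣value ws)) ℓ≤length
          ss , ss⊆ws , values≡B = Infix-map⁻ value B⊆values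
      in elements ss ,
         Infix-trans (Infix-concat⁺ (Infix-map⁺ proj₁ ss⊆ws)) ws⊆xs ,
         zeroSum-elements ss (subst (IsAWeightedZeroSumMod N) (sym values≡B) B-zeroSum)
      where
      open Parse parse
      d∣segments : All (All (λ x → d ∣ toℕ x)) segments
      d∣segments = concat⁻ (++⁻ˡ (concat segments) (++⁻ʳ before (subst (All _) split d∣xs)))
      ws : List (WeightedSegment Q)
      ws = All.toList (All.zipWith (λ (seg , d∣seg) → segmentWeighting seg d∣seg) (valid , d∣segments))
      ws≡segments : map proj₁ ws ≡ segments
      ws≡segments = toList-proj₁ _
      ℓ≤length : ℓ ≤ length (map value ws)
      ℓ≤length = ≤-trans ℓ≤count (≤-reflexive (begin
        length segments           ≡⟨ cong length ws≡segments ⟨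
        length (map proj₁ ws)     ≡⟨ length-map proj₁ ws ⟩
        length ws                 ≡⟨ length-map value ws ⟨
        length (map value ws)     ∎))
        where open ≡-Reasoning
      ws⊆xs : Infix (elements ws) xs
      ws⊆xs = subst (λ l → Infix l xs) (cong concat (sym ws≡segments)) (before , after , split)

    step : ∀ {j} → HasZeroSumBlocksFrom (3 ^ j) →
           ∀ {xs} → All (λ x → d ∣ toℕ x) xs → 3 ^ suc j ≤ length xs → HasZeroSumBlock xs
    step {j} blocksQ {xs} d∣xs long =
      let parse , length≤ = segmentation xs
      in expandBlock blocksQ d∣xs parse (3^[1+j]≤3s+2⇒3^j≤s j (count parse) (≤-trans long length≤))

  hasZeroSumBlock : ∀ {m j d xs} → HasΩ m j → d * m ≡ N → All (λ x → d ∣ toℕ x) xs → 3 ^ j ≤ length xs →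
    HasZeroSumBlock xs
  hasZeroSumBlock {d = d} Ω-one d*1≡N d∣xs =
    singletonBlock (subst (λ n → All (λ x → n ∣ toℕ x) _) (trans (sym (*-identityʳ d)) d*1≡N) d∣xs)
  hasZeroSumBlock {d = d} (Ω-step {p} {m} {j} p-prime Ωm) d*pm≡N =
    Step.step p-prime d*pm≡N {j} (hasZeroSumBlock Ωm (trans (*-assoc d p m) d*pm≡N))

mainTheorem16 : (n : ℕ) .{{_ : NonZero n}} → 1 < n →
    (∀ p → Prime p → p ∣ n → 7 ≤ p) →
    (k : ℕ) → HasΩ n k →
    (S : List (Fin n)) (q : ℕ) → Prime q → q ∣ n →
    (T : List (Fin n)) → IsConsecutiveBlock T S →
    ((3 ^ k ∸ 1) + 1 ≤ 3 * length T) →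
    All (λ x → q ∣ toℕ x) T →
    ∃ λ (B : List (Fin n)) → IsConsecutiveBlock B S × IsAWeightedZeroSum n B
mainTheorem16 n _ n-factors≥7 k Ωn S q q-prime q∣n T (_ , T⊆S) long q∣T =
  let k′ , k≡1+k′ , m , qm≡n , Ωm = HasΩ-cofactor Ωn q-prime q∣n
      3^k≤3|T| = subst (_≤ 3 * length T) (m∸n+n≡m (m^n>0 3 k)) long
      3^k′≤|T| = *-cancelˡ-≤ 3 (subst (λ k → 3 ^ k ≤ 3 * length T) k≡1+k′ 3^k≤3|T|)
      B , B⊆T , B-zeroSum = hasZeroSumBlock Ωm qm≡n q∣T 3^k′≤|T|
  in B , (IsAWeightedZeroSumMod.nonempty B-zeroSum , Infix-trans B⊆T T⊆S) , toIsAWeightedZeroSum B-zeroSum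
  where
  open Weights n
  open ZeroSumBlocks n n-factors≥7 Ωn
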